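{- Let $n\ge 1$, let $A\subseteq[n]$, and let $A^*=\{n+1-i : i\in[n]\setminus A\}$ be the reverse complement of $A$. Let $C_1=D_{[n]}(A)$ and $C_2=D_{[n]}(A^*)$. Then $C_2$ is obtained from $C_1$ by first reversing every order in $C_1$ and then renaming each alternative $i$ as $n+1-i$; that is, $C_2=\{\psi(\mathrm{rev}(x)) : x\in C_1\}$, where $\mathrm{rev}(x)$ is the reverse of the linear order $x$ and $\psi$ relabels alternative $i$ as $n+1-i$.
   Context: The set of alternatives is $[n]=\{1,\dots,n\}$, with its natural order as societal axis. For a triple $i<j<k$ of alternatives, the never condition $1N3$ on a set of linear orders means that in every order of the set, $i$ is not ranked last among $i,j,k$ (in the restriction of the order to $\{i,j,k\}$); the never condition $3N1$ means that $k$ is not ranked first among $i,j,k$. For $A\subseteq[n]$, the set-alternating scheme generated by $A$ assigns to each triple $i<j<k$ the condition $1N3$ if $j\in A$ and the condition $3N1$ if $j\notin A$. $D_{[n]}(A)$ denotes the set of all linear orders on $[n]$ satisfying every condition assigned by this scheme. -}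

module Defs where

open import Data.Nat using (ℕ)
open import Data.Fin using (Fin; _<_; opposite)
open import Data.Fin.Subset using (Subset; _∈_; _∉_; ∁)
open import Data.Vec using (tabulate; lookup)
open import Data.Bool using (not)
open import Data.List using (List; _∷_; _++_; map; reverse)
import Data.List.Membership.Propositional as LM
open import Data.List.Relation.Unary.Unique.Propositional using (Unique)
open import Data.Product using (Σ; _×_; ∃)
open import Data.Sum using (_⊎_)
open import Relation.Binary.PropositionalEquality using (_≡_)

-- Alternatives [n] are represented by Fin n (element i : Fin n stands for i+1).
-- A linear order on [n] is represented by the list of all alternatives,
-- ranked from first (top) to last (bottom), each appearing exactly once.
IsLinearOrder : (n : ℕ) → List (Fin n) → Set
IsLinearOrder n xs = Unique xs × (∀ (a : Fin n) → a LM.∈ xs)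

Above : ∀ {n} → List (Fin n) → Fin n → Fin n → Set
Above xs a b = Σ (List _) λ l₁ → Σ (List _) λ l₂ → (xs ≡ l₁ ++ (a ∷ l₂)) × (b LM.∈ l₂)

Never1N3 : ∀ {n} → List (Fin n) → Fin n → Fin n → Fin n → Set
Never1N3 xs i j k = Above xs i j ⊎ Above xs i k

Never3N1 : ∀ {n} → List (Fin n) → Fin n → Fin n → Fin n → Set
Never3N1 xs i j k = Above xs i k ⊎ Above xs j k

InD : (n : ℕ) → Subset n → List (Fin n) → Set
InD n A xs = IsLinearOrder n xs ×
  (∀ (i j k : Fin n) → i < j → j < k →
     (j ∈ A → Never1N3 xs i j k) × (j ∉ A → Never3N1 xs i j k))

-- reverse complement A* = { n+1-i : i ∈ [n] \ A }  (opposite i = n-1-i on Fin n)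
revComp : ∀ {n} → Subset n → Subset n
revComp {n} A = tabulate λ i → lookup (∁ A) (opposite i)

psiRev : ∀ {n} → List (Fin n) → List (Fin n)
psiRev xs = map opposite (reverse xs)

{-# OPTIONS --safe #-}
module Submission where

open import Defs
open import Data.Nat using (ℕ; _≥_)
open import Data.Nat.Properties using (∸-monoʳ-<; +-monoʳ-≤)
open import Data.Bool using (true; false; not)
open import Data.Bool.Properties using (not-involutive)
open import Data.Fin using (Fin; opposite; _<_)
open import Data.Fin.Properties using (opposite-involutive; opposite-prop; toℕ<n)
open import Data.Fin.Subset using (Subset; _∈_; _∉_)
open import Data.Vec using (lookup)
open import Data.Vec.Properties using ([]=⇒lookup; lookup⇒[]=; lookup∘tabulate; lookup-map)
open import Data.List using (List; []; _∷_; _++_; map; reverse)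
open import Data.List.Properties
  using (reverse-++; unfold-reverse; ++-assoc; map-++; reverse-map; reverse-involutive; map-∘; map-cong; map-id)
open import Data.List.Relation.Unary.Any using (here)
import Data.List.Relation.Unary.Any.Properties as Any
import Data.List.Membership.Propositional as Membership
open import Data.List.Membership.Propositional.Properties using (∈-∃++; ∈-map⁺; ∈-++⁺ʳ)
import Data.List.Relation.Unary.Unique.Propositional.Properties as Unique
import Data.List.Relation.Binary.Permutation.Setoid as Permutation
import Data.List.Relation.Binary.Permutation.Setoid.Properties as Permutation
open import Data.Product using (Σ; _×_; _,_; proj₁; proj₂)
open import Data.Sum using (swap) renaming (map to map⊎)
open import Function using (_∘_)
open import Function.Bundles using (_⇔_; mk⇔)
open import Relation.Nullary using (contradiction)
open import Relation.Binary.PropositionalEquality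

-- The map x ↦ ψ(rev x) is an involution on rankings which turns "a above b"
-- into "ψb above ψa".  Hence it sends the triple i < j < k to ψk < ψj < ψi,
-- turning "i not last" (1N3) into "ψi not first" (3N1) and vice versa, while
-- the middle alternative j ∈ A becomes ψj ∉ A*.  So ψ∘rev maps D(A) into
-- D(A*), and as A** = A it is a bijection between them.

opposite-injective : ∀ {n} {i j : Fin n} → opposite i ≡ opposite j → i ≡ j
opposite-injective {i = i} {j} eq = begin
  i                       ≡⟨ opposite-involutive i ⟨
  opposite (opposite i)   ≡⟨ cong opposite eq ⟩
  opposite (opposite j)   ≡⟨ opposite-involutive j ⟩
  j                       ∎
  where open ≡-Reasoning

opposite-reverses-< : ∀ {n} {i j : Fin n} → i < j → opposite j < opposite i
opposite-reverses-< {n} {i} {j} i<j rewrite opposite-prop i | opposite-prop j =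
  ∸-monoʳ-< {n} (+-monoʳ-≤ 1 i<j) (toℕ<n j)

reverse-++-∷ : ∀ {A : Set} (xs : List A) y ys → reverse (xs ++ y ∷ ys) ≡ reverse ys ++ y ∷ reverse xs
reverse-++-∷ xs y ys = begin
  reverse (xs ++ y ∷ ys)               ≡⟨ reverse-++ xs (y ∷ ys) ⟩
  reverse (y ∷ ys) ++ reverse xs       ≡⟨ cong (_++ reverse xs) (unfold-reverse y ys) ⟩
  (reverse ys ++ y ∷ []) ++ reverse xs ≡⟨ ++-assoc (reverse ys) (y ∷ []) (reverse xs) ⟩
  reverse ys ++ y ∷ reverse xs         ∎
  where open ≡-Reasoning

psiRev-involutive : ∀ {n} (xs : List (Fin n)) → psiRev (psiRev xs) ≡ xs
psiRev-involutive xs = begin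
  map opposite (reverse (map opposite (reverse xs))) ≡⟨ cong (map opposite) (reverse-map opposite (reverse xs)) ⟨
  map opposite (map opposite (reverse (reverse xs))) ≡⟨ map-∘ (reverse (reverse xs)) ⟨
  map (opposite ∘ opposite) (reverse (reverse xs))   ≡⟨ map-cong opposite-involutive _ ⟩
  map (λ z → z) (reverse (reverse xs))               ≡⟨ map-id _ ⟩
  reverse (reverse xs)                               ≡⟨ reverse-involutive xs ⟩
  xs                                                 ∎
  where open ≡-Reasoning

IsLinearOrder-psiRev : ∀ {n} {xs : List (Fin n)} → IsLinearOrder n xs → IsLinearOrder n (psiRev xs)
IsLinearOrder-psiRev {n} {xs} (unique , complete) =
  Unique.map⁺ opposite-injective
    (Permutation.Unique-resp-↭ S (Permutation.↭-sym S (Permutation.↭-reverse S xs)) unique) ,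
  λ a → subst (Membership._∈ psiRev xs) (opposite-involutive a)
          (∈-map⁺ opposite (Any.reverse⁺ (complete (opposite a))))
  where S = setoid (Fin n)

Above-psiRev : ∀ {n} {xs : List (Fin n)} {a b} → Above xs a b → Above (psiRev xs) (opposite b) (opposite a)
Above-psiRev {xs = xs} {a} {b} (l₁ , l₂ , xs≡l₁al₂ , b∈l₂) with ∈-∃++ b∈l₂
... | m₁ , m₂ , refl =
  map opposite (reverse m₂) , map opposite (reverse m₁ ++ a ∷ reverse l₁) , split ,
  ∈-map⁺ opposite (∈-++⁺ʳ (reverse m₁) (here refl))
  where
  open ≡-Reasoning
  split : psiRev xs ≡ map opposite (reverse m₂) ++ opposite b ∷ map opposite (reverse m₁ ++ a ∷ reverse l₁)
  split = begin
    map opposite (reverse xs)                                 ≡⟨ cong (map opposite ∘ reverse) xs≡l₁al₂ ⟩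
    map opposite (reverse (l₁ ++ a ∷ m₁ ++ b ∷ m₂))           ≡⟨ cong (map opposite) (reverse-++-∷ l₁ a (m₁ ++ b ∷ m₂)) ⟩
    map opposite (reverse (m₁ ++ b ∷ m₂) ++ a ∷ reverse l₁)    ≡⟨ cong (λ z → map opposite (z ++ a ∷ reverse l₁)) (reverse-++-∷ m₁ b m₂) ⟩
    map opposite ((reverse m₂ ++ b ∷ reverse m₁) ++ a ∷ reverse l₁)
      ≡⟨ cong (map opposite) (++-assoc (reverse m₂) (b ∷ reverse m₁) (a ∷ reverse l₁)) ⟩
    map opposite (reverse m₂ ++ b ∷ (reverse m₁ ++ a ∷ reverse l₁))
      ≡⟨ map-++ opposite (reverse m₂) _ ⟩
    map opposite (reverse m₂) ++ opposite b ∷ map opposite (reverse m₁ ++ a ∷ reverse l₁) ∎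

Above-opposite-psiRev : ∀ {n} {xs : List (Fin n)} {a b} →
  Above xs (opposite b) (opposite a) → Above (psiRev xs) a b
Above-opposite-psiRev {xs = xs} {a} {b} =
  subst₂ (Above (psiRev xs)) (opposite-involutive a) (opposite-involutive b) ∘ Above-psiRev

Never3N1⇒Never1N3-psiRev : ∀ {n} {xs : List (Fin n)} {i j k} →
  Never3N1 xs (opposite k) (opposite j) (opposite i) → Never1N3 (psiRev xs) i j k
Never3N1⇒Never1N3-psiRev = swap ∘ map⊎ Above-opposite-psiRev Above-opposite-psiRev

Never1N3⇒Never3N1-psiRev : ∀ {n} {xs : List (Fin n)} {i j k} →
  Never1N3 xs (opposite k) (opposite j) (opposite i) → Never3N1 (psiRev xs) i j k
Never1N3⇒Never3N1-psiRev = swap ∘ map⊎ Above-opposite-psiRev Above-opposite-psiRev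

ReverseComplement : ∀ {n} → Subset n → Subset n → Set
ReverseComplement A B = ∀ j → lookup B j ≡ not (lookup A (opposite j))

revComp-reverseComplement : ∀ {n} (A : Subset n) → ReverseComplement A (revComp A)
revComp-reverseComplement A j = trans (lookup∘tabulate _ j) (lookup-map (opposite j) not A)

ReverseComplement-sym : ∀ {n} {A B : Subset n} → ReverseComplement A B → ReverseComplement B A
ReverseComplement-sym {A = A} {B} rc j = sym (begin
  not (lookup B (opposite j))                  ≡⟨ cong not (rc (opposite j)) ⟩
  not (not (lookup A (opposite (opposite j)))) ≡⟨ not-involutive _ ⟩
  lookup A (opposite (opposite j))             ≡⟨ cong (lookup A) (opposite-involutive j) ⟩
  lookup A j                                   ∎)
  where open ≡-Reasoning

ReverseComplement-∈ : ∀ {n} {A B : Subset n} {j} → ReverseComplement A B → j ∈ B → opposite j ∉ A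
ReverseComplement-∈ {j = j} rc j∈B oj∈A =
  contradiction (trans (sym ([]=⇒lookup j∈B)) (trans (rc j) (cong not ([]=⇒lookup oj∈A)))) λ ()

ReverseComplement-∉ : ∀ {n} {A B : Subset n} {j} → ReverseComplement A B → j ∉ B → opposite j ∈ A
ReverseComplement-∉ {A = A} {B} {j} rc j∉B with lookup A (opposite j) in eq
... | true  = lookup⇒[]= (opposite j) A eq
... | false = contradiction (lookup⇒[]= j B (trans (rc j) (cong not eq))) j∉B

InD-psiRev : ∀ {n} {A B : Subset n} → ReverseComplement A B →
  ∀ {y} → InD n A y → InD n B (psiRev y)
InD-psiRev rc (linear , never) = IsLinearOrder-psiRev linear , λ i j k i<j j<k →
  let never-opp = never (opposite k) (opposite j) (opposite i)
                        (opposite-reverses-< j<k) (opposite-reverses-< i<j)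
  in (λ j∈B → Never3N1⇒Never1N3-psiRev (proj₂ never-opp (ReverseComplement-∈ rc j∈B))) ,
     (λ j∉B → Never1N3⇒Never3N1-psiRev (proj₁ never-opp (ReverseComplement-∉ rc j∉B)))

mainTheorem1 : (n : ℕ) → n ≥ 1 → (A : Subset n) → (x : List (Fin n)) →
    InD n (revComp A) x ⇔ (Σ (List (Fin n)) λ y → InD n A y × (x ≡ psiRev y))
mainTheorem1 n _ A x = mk⇔
  (λ x∈D* → psiRev x , InD-psiRev (ReverseComplement-sym {A = A} {revComp A} rc) x∈D* , sym (psiRev-involutive x))
  (λ { (y , y∈D , refl) → InD-psiRev rc y∈D })
  where
  rc : ReverseComplement A (revComp A)
  rc = revComp-reverseComplement A
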